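{- Let $1\le i\le j\le n-1$ and $v\in S_n$. Then $$(s_is_{i+1}\cdots s_j)\star v=h_{i,[i+1,i+2,\dots,j+1]}\,(s_is_{i+1}\cdots s_j\,v).$$
   Context: $S_n$ is the symmetric group on $[n]=\{1,\dots,n\}$, with permutations written in one-line notation $w(1)\cdots w(n)$. Products are compositions, $(wv)(k)=w(v(k))$, so left multiplication by $u$ replaces each entry $x$ by $u(x)$. Let $s_i$ be the transposition $(i,i+1)$, and let $\ell$ be Coxeter length (number of inversions). The Demazure product $\star$ is the associative product determined by the following rules: - $s_i\star u=u$ if $\ell(s_iu)<\ell(u)$, and $s_i\star u=s_iu$ otherwise; - $w\star u=s_{a_1}\star(\cdots\star(s_{a_k}\star u))$ for any reduced word $w=s_{a_1}\cdots s_{a_k}$. Hopping operator: let $t\in[n]$ and let $L$ be an ordered list of distinct elements of $[n]$. The map $h_{t,L}:S_n\to S_n$ acts on $w$ by the following iteration. - Consider the entries of the one-line notation of $w$ to the right of $t$ that belong to $L$ and are greater than $t$. - If there are none, output $w$. - Otherwise, let $q$ be the one among them occurring latest in the list $L$. Swap the positions of $t$ and $q$, replace $w$ by the result, and repeat. -}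

module Defs where

open import Data.Nat using (ℕ; zero; suc; _+_; _∸_; _<_; _<?_; _≟_)
open import Data.Bool using (Bool; true; false; if_then_else_)
open import Data.List using (List; []; _∷_; length; filter; applyUpTo; reverse; foldr; map)
open import Data.Maybe using (Maybe; just; nothing)
open import Data.List.Membership.DecPropositional _≟_ using (_∈?_)
open import Data.List.Relation.Binary.Permutation.Propositional using (_↭_)
open import Relation.Nullary using (does)
open import Relation.Binary.PropositionalEquality using (_≡_)

-- Permutations of [n] = {1,…,n} are represented by their one-line
-- notation w(1) ⋯ w(n), a list of natural numbers.
IsPerm : ℕ → List ℕ → Set
IsPerm n w = w ↭ applyUpTo suc n

-- Left multiplication by the transposition (a b): replace every entry
-- a by b and every entry b by a.  (Equivalently: swap the positions of
-- the values a and b in the one-line notation.)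
swapVals : ℕ → ℕ → List ℕ → List ℕ
swapVals a b = map f
  where
  f : ℕ → ℕ
  f x = if does (x ≟ a) then b else (if does (x ≟ b) then a else x)

sMul : ℕ → List ℕ → List ℕ
sMul i = swapVals i (suc i)

-- Coxeter length = number of inversions
len : List ℕ → ℕ
len []       = 0
len (x ∷ xs) = length (filter (λ y → y <? x) xs) + len xs

sDem : ℕ → List ℕ → List ℕ
sDem i u = if does (len (sMul i u) <? len u) then u else sMul i u

demWord : List ℕ → List ℕ → List ℕ
demWord ws u = foldr sDem u ws

mulWord : List ℕ → List ℕ → List ℕ
mulWord ws u = foldr sMul u ws

interval : ℕ → ℕ → List ℕ
interval a b = applyUpTo (a +_) (suc (b ∸ a))

rightOf : ℕ → List ℕ → List ℕ
rightOf t []       = []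
rightOf t (x ∷ xs) = if does (x ≟ t) then xs else rightOf t xs

candidate : ℕ → List ℕ → List ℕ → Maybe ℕ
candidate t L w = go (reverse L)
  where
  go : List ℕ → Maybe ℕ
  go []       = nothing
  go (q ∷ qs) = if does (t <? q) then (if does (q ∈? rightOf t w) then just q else go qs) else go qs

-- Hop t L w w' : iterating the hopping procedure h_{t,L} on w terminates
-- with output w'.  (The procedure is deterministic, so this is the graph
-- of h_{t,L}.)
data Hop (t : ℕ) (L : List ℕ) : List ℕ → List ℕ → Set where
  stop : ∀ {w} → candidate t L w ≡ nothing → Hop t L w w
  step : ∀ {w w' q} → candidate t L w ≡ just q →
         Hop t L (swapVals t q w) w' → Hop t L w w'

-- Induction on j − i.  The word s_i s_{i+1} ⋯ s_j is s_i followed by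
-- s_{i+1} ⋯ s_j; by induction h_{i+1,[i+2,…,j+1]} carries s_{i+1} ⋯ s_j v to
-- u = (s_{i+1} ⋯ s_j) ⋆ v.  Left multiplication by s_i writes i where i+1
-- stood, so every one of these hops of i+1 becomes a hop of i on the
-- s_i-translates, and h_{i,[i+1,…,j+1]} carries s_i ⋯ s_j v to s_i u.  At s_i u
-- one more hop (of i over i+1) happens exactly when i+1 lies right of i in
-- s_i u, i.e. when ℓ(s_i u) < ℓ(u); it leads to u = s_i ⋆ u, where the process
-- stops.  Otherwise the process already stops at s_i u = s_i ⋆ u.
module Submission where

open import Defs
open import Data.Bool using (true; false; if_then_else_)
open import Data.Empty using (⊥-elim)
open import Data.List using (List; []; _∷_; [_]; _++_; map; filter; length; reverse; applyUpTo; find)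
open import Data.List.Properties using (unfold-reverse; map-∘; map-cong; map-id; filter-accept; filter-reject)
open import Data.List.Membership.Propositional using (_∈_; _∉_)
open import Data.List.Membership.Propositional.Properties using (∈-map⁺; ∈-map⁻; ∈-applyUpTo⁺)
open import Data.Nat using (ℕ; zero; suc; _+_; _∸_; _≤_; _<_; _<ᵇ_; _≡ᵇ_; _<?_; _≟_; z≤n; s≤s; z<s)
open import Data.List.Membership.DecPropositional _≟_ using (_∈?_)
open import Data.List.Relation.Binary.Permutation.Propositional using (↭-sym; ↭⇒↭ₛ)
open import Data.List.Relation.Binary.Permutation.Propositional.Properties using (∈-resp-↭)
open import Data.List.Relation.Binary.Permutation.Setoid.Properties using (Unique-resp-↭)
open import Data.List.Relation.Unary.All as All using (All; []; _∷_)
open import Data.List.Relation.Unary.All.Properties using (All¬⇒¬Any)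
open import Data.List.Relation.Unary.AllPairs using (_∷_)
open import Data.List.Relation.Unary.Any as Any using (here; there)
open import Data.List.Relation.Unary.Any.Properties using (reverse⁺; reverse⁻)
open import Data.List.Relation.Unary.Unique.Propositional using (Unique)
open import Data.List.Relation.Unary.Unique.Propositional.Properties using (map⁺; applyUpTo⁺₁)
open import Data.Maybe using (Maybe; just; nothing; _<∣>_)
open import Data.Maybe.Properties using (just-injective)
open import Data.Nat.Properties
  using (≤-refl; ≤-trans; ≤-reflexive; <-irrefl; <⇒≤; <⇒≢; ≤-pred; ≤∧≢⇒<; n<1+n; m<n⇒m<1+n;
         1+n≰n; m<m+n; +-suc; +-identityʳ; m+[n∸m]≡n; suc-injective)
open import Data.Product using (_×_; _,_; proj₁)
open import Data.Sum using (_⊎_; inj₁; inj₂)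
open import Function using (_∘_; id; _⇔_; mk⇔; Equivalence)
open import Function.Definitions using (Injective)
open import Function.Construct.Identity using (⇔-id)
open import Function.Construct.Symmetry using (⇔-sym)
open import Relation.Binary.PropositionalEquality
  using (_≡_; _≢_; refl; sym; trans; cong; cong₂; subst; subst₂; setoid; module ≡-Reasoning)
open import Relation.Nullary using (¬_; Dec; yes; no; does; proof)
open import Relation.Nullary.Decidable using (_×-dec_; dec-true)
open import Relation.Nullary.Reflects using (ofʸ; ofⁿ)
open import Relation.Unary using (Decidable)

open Equivalence using (to; from)
open ≡-Reasoning

-- Transpositions of values

-- `swapVals a b` is definitionally `map (transpose a b)`, and hence `sMul i`
-- is definitionally `map (s i)`.
transpose : ℕ → ℕ → ℕ → ℕ
transpose a b x = if does (x ≟ a) then b else (if does (x ≟ b) then a else x)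

s : ℕ → ℕ → ℕ
s i = transpose i (suc i)

data Transposed (a b x : ℕ) : ℕ → Set where
  moved-a : x ≡ a → Transposed a b x b
  moved-b : x ≢ a → x ≡ b → Transposed a b x a
  fixed   : x ≢ a → x ≢ b → Transposed a b x x

-- `does (x ≟ a)` computes to `x ≡ᵇ a`, so a goal mentioning the test is split
-- on that boolean together with its `proof`; likewise for `_<?_` and `_<ᵇ_`.
transposed : ∀ a b x → Transposed a b x (transpose a b x)
transposed a b x with x ≡ᵇ a | proof (x ≟ a)
... | true  | ofʸ x≡a = moved-a x≡a
... | false | ofⁿ x≢a with x ≡ᵇ b | proof (x ≟ b)
...   | true  | ofʸ x≡b = moved-b x≢a x≡b
...   | false | ofⁿ x≢b = fixed x≢a x≢b

transposeˡ : ∀ a b → transpose a b a ≡ b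
transposeˡ a b with transpose a b a | transposed a b a
... | _ | moved-a _     = refl
... | _ | moved-b a≢a _ = ⊥-elim (a≢a refl)
... | _ | fixed a≢a _   = ⊥-elim (a≢a refl)

transposeʳ : ∀ a b → transpose a b b ≡ a
transposeʳ a b with transpose a b b | transposed a b b
... | _ | moved-a refl = refl
... | _ | moved-b _ _  = refl
... | _ | fixed _ b≢b  = ⊥-elim (b≢b refl)

transpose-fixed : ∀ {a b x} → x ≢ a → x ≢ b → transpose a b x ≡ x
transpose-fixed {a} {b} {x} x≢a x≢b with transpose a b x | transposed a b x
... | _ | moved-a x≡a   = ⊥-elim (x≢a x≡a)
... | _ | moved-b _ x≡b = ⊥-elim (x≢b x≡b)
... | _ | fixed _ _     = refl

transpose-involutive : ∀ a b x → transpose a b (transpose a b x) ≡ x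
transpose-involutive a b x with transpose a b x | transposed a b x
... | _ | moved-a refl   = transposeʳ x b
... | _ | moved-b _ refl = transposeˡ a x
... | _ | fixed x≢a x≢b  = transpose-fixed x≢a x≢b

transpose-injective : ∀ a b → Injective _≡_ _≡_ (transpose a b)
transpose-injective a b {x} {y} eq = begin
  x                                   ≡⟨ sym (transpose-involutive a b x) ⟩
  transpose a b (transpose a b x)     ≡⟨ cong (transpose a b) eq ⟩
  transpose a b (transpose a b y)     ≡⟨ transpose-involutive a b y ⟩
  y                                   ∎

transpose-conjugate : ∀ {f} → Injective _≡_ _≡_ f → ∀ a b x →
  transpose (f a) (f b) (f x) ≡ f (transpose a b x)
transpose-conjugate {f} f-inj a b x with transpose a b x | transposed a b x
... | _ | moved-a refl   = transposeˡ (f x) (f b)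
... | _ | moved-b _ refl = transposeʳ (f a) (f x)
... | _ | fixed x≢a x≢b  = transpose-fixed (x≢a ∘ f-inj) (x≢b ∘ f-inj)

transpose-preserves : ∀ {P : ℕ → Set} a b x → P a → P b → P x → P (transpose a b x)
transpose-preserves a b x Pa Pb Px with transpose a b x | transposed a b x
... | _ | moved-a _   = Pb
... | _ | moved-b _ _ = Pa
... | _ | fixed _ _   = Px

map-transpose-involutive : ∀ a b w → map (transpose a b) (map (transpose a b) w) ≡ w
map-transpose-involutive a b w = begin
  map (transpose a b) (map (transpose a b) w)   ≡⟨ sym (map-∘ w) ⟩
  map (transpose a b ∘ transpose a b) w         ≡⟨ map-cong (transpose-involutive a b) w ⟩
  map id w                                      ≡⟨ map-id w ⟩
  w                                             ∎

∈-map-transpose⁺ : ∀ {a b x w} → transpose a b x ∈ w → x ∈ map (transpose a b) w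
∈-map-transpose⁺ {a} {b} {x} m = subst (_∈ _) (transpose-involutive a b x) (∈-map⁺ (transpose a b) m)

∈-map-transpose⁻ : ∀ {a b x w} → x ∈ map (transpose a b) w → transpose a b x ∈ w
∈-map-transpose⁻ {a} {b} m with ∈-map⁻ (transpose a b) m
... | z , z∈w , refl = subst (_∈ _) (sym (transpose-involutive a b z)) z∈w

-- Relative positions of entries

rightOf-head : ∀ c w → rightOf c (c ∷ w) ≡ w
rightOf-head c w with c ≡ᵇ c | proof (c ≟ c)
... | true  | ofʸ _   = refl
... | false | ofⁿ c≢c = ⊥-elim (c≢c refl)

rightOf-tail : ∀ {c x} w → x ≢ c → rightOf c (x ∷ w) ≡ rightOf c w
rightOf-tail {c} {x} w x≢c with x ≡ᵇ c | proof (x ≟ c)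
... | true  | ofʸ x≡c = ⊥-elim (x≢c x≡c)
... | false | ofⁿ _   = refl

rightOf-⊆ : ∀ {c} w {y} → y ∈ rightOf c w → y ∈ w
rightOf-⊆ {c} (x ∷ w) y∈ with x ≡ᵇ c | proof (x ≟ c)
... | true  | ofʸ _ = there y∈
... | false | ofⁿ _ = there (rightOf-⊆ w y∈)

rightOf-map : ∀ {f} → Injective _≡_ _≡_ f → ∀ c w → rightOf (f c) (map f w) ≡ map f (rightOf c w)
rightOf-map f-inj c [] = refl
rightOf-map {f} f-inj c (x ∷ w) with x ≡ᵇ c | proof (x ≟ c) | f x ≡ᵇ f c | proof (f x ≟ f c)
... | true  | ofʸ _    | true  | ofʸ _     = refl
... | true  | ofʸ refl | false | ofⁿ fx≢fx = ⊥-elim (fx≢fx refl)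
... | false | ofⁿ x≢c  | true  | ofʸ fx≡fc = ⊥-elim (x≢c (f-inj fx≡fc))
... | false | ofⁿ _    | false | ofⁿ _     = rightOf-map f-inj c w

rightOf-irrefl : ∀ {c w} → Unique w → c ∉ rightOf c w
rightOf-irrefl {c} {x ∷ w} (x∉w ∷ w!) c∈ with x ≡ᵇ c | proof (x ≟ c)
... | true  | ofʸ refl = All¬⇒¬Any x∉w c∈
... | false | ofⁿ _    = rightOf-irrefl w! c∈

rightOf-trans : ∀ {c d w y} → Unique w → c ∈ rightOf d w → y ∈ rightOf c w → y ∈ rightOf d w
rightOf-trans {c} {d} {x ∷ w} (x∉w ∷ w!) c∈ y∈ with x ≡ᵇ d | proof (x ≟ d) | x ≡ᵇ c | proof (x ≟ c)
... | true  | ofʸ _ | true  | ofʸ _    = y∈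
... | true  | ofʸ _ | false | ofⁿ _    = rightOf-⊆ w y∈
... | false | ofⁿ _ | true  | ofʸ refl = ⊥-elim (All¬⇒¬Any x∉w (rightOf-⊆ w c∈))
... | false | ofⁿ _ | false | ofⁿ _    = rightOf-trans w! c∈ y∈

rightOf-total : ∀ {a b w} → a ≢ b → a ∈ w → b ∈ w → a ∈ rightOf b w ⊎ b ∈ rightOf a w
rightOf-total {a} {b} {x ∷ w} a≢b a∈ b∈ with x ≡ᵇ b | proof (x ≟ b) | x ≡ᵇ a | proof (x ≟ a)
... | true  | ofʸ refl | true  | ofʸ refl = ⊥-elim (a≢b refl)
... | true  | ofʸ refl | false | ofⁿ x≢a  = inj₁ (Any.tail (x≢a ∘ sym) a∈)
... | false | ofⁿ x≢b  | true  | ofʸ refl = inj₂ (Any.tail (x≢b ∘ sym) b∈)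
... | false | ofⁿ x≢b  | false | ofⁿ x≢a  =
  rightOf-total a≢b (Any.tail (x≢a ∘ sym) a∈) (Any.tail (x≢b ∘ sym) b∈)

rightOf-sMul : ∀ i w → rightOf i (sMul i w) ≡ sMul i (rightOf (suc i) w)
rightOf-sMul i w =
  subst (λ c → rightOf c (sMul i w) ≡ sMul i (rightOf (suc i) w))
        (transposeʳ i (suc i)) (rightOf-map (transpose-injective i (suc i)) (suc i) w)

suc∈rightOf-sMul⇔ : ∀ i w → suc i ∈ rightOf i (sMul i w) ⇔ i ∈ rightOf (suc i) w
suc∈rightOf-sMul⇔ i w = mk⇔
  (λ si∈ → subst (_∈ rightOf (suc i) w) (transposeʳ i (suc i))
              (∈-map-transpose⁻ (subst (suc i ∈_) (rightOf-sMul i w) si∈)))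
  (λ i∈ → subst (suc i ∈_) (sym (rightOf-sMul i w))
            (∈-map-transpose⁺ (subst (_∈ rightOf (suc i) w) (sym (transposeʳ i (suc i))) i∈)))

find-++ : ∀ {A : Set} {P : A → Set} (P? : Decidable P) xs ys →
  find P? (xs ++ ys) ≡ (find P? xs <∣> find P? ys)
find-++ P? []       ys = refl
find-++ P? (x ∷ xs) ys with does (P? x)
... | true  = refl
... | false = find-++ P? xs ys

find-just⇒∈ : ∀ {A : Set} {P : A → Set} (P? : Decidable P) xs {y} → find P? xs ≡ just y → y ∈ xs
find-just⇒∈ P? (x ∷ xs) eq with does (P? x)
... | true  = here (sym (just-injective eq))
... | false = there (find-just⇒∈ P? xs eq)

find-nothing⇒¬ : ∀ {A : Set} {P : A → Set} (P? : Decidable P) xs →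
  find P? xs ≡ nothing → ∀ {y} → y ∈ xs → ¬ P y
find-nothing⇒¬ P? (x ∷ xs) eq y∈ Py with P? x | y∈
find-nothing⇒¬ P? (x ∷ xs) () y∈ Py | yes _   | _
... | no ¬Px | here refl  = ¬Px Py
... | no _   | there y∈xs = find-nothing⇒¬ P? xs eq y∈xs Py

¬⇒find-nothing : ∀ {A : Set} {P : A → Set} (P? : Decidable P) xs →
  (∀ {y} → y ∈ xs → ¬ P y) → find P? xs ≡ nothing
¬⇒find-nothing P? []       ¬P = refl
¬⇒find-nothing P? (x ∷ xs) ¬P with P? x
... | yes Px = ⊥-elim (¬P (here refl) Px)
... | no _   = ¬⇒find-nothing P? xs (¬P ∘ there)

find-cong : ∀ {A : Set} {P Q : A → Set} (P? : Decidable P) (Q? : Decidable Q) xs →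
  (∀ {y} → y ∈ xs → P y ⇔ Q y) → find P? xs ≡ find Q? xs
find-cong P? Q? []       P⇔Q = refl
find-cong P? Q? (x ∷ xs) P⇔Q with P? x | Q? x
... | yes _   | yes _   = refl
... | no _    | no _    = find-cong P? Q? xs (P⇔Q ∘ there)
... | yes Px  | no ¬Qx  = ⊥-elim (¬Qx (to (P⇔Q (here refl)) Px))
... | no ¬Px  | yes Qx  = ⊥-elim (¬Px (from (P⇔Q (here refl)) Qx))

-- The hopping candidate

Hoppable : ℕ → List ℕ → ℕ → Set
Hoppable t w q = t < q × q ∈ rightOf t w

hoppable? : ∀ t w → Decidable (Hoppable t w)
hoppable? t w q = t <? q ×-dec q ∈? rightOf t w

if-does-×-dec : ∀ {A B C : Set} (a? : Dec A) (b? : Dec B) (x y : C) →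
  (if does a? then (if does b? then x else y) else y) ≡ (if does (a? ×-dec b?) then x else y)
if-does-×-dec (yes _) b? x y = refl
if-does-×-dec (no _)  b? x y = refl

find-unique : ∀ {A : Set} {P : A → Set} (P? : Decidable P) (g : List A → Maybe A) →
  g [] ≡ nothing → (∀ q qs → g (q ∷ qs) ≡ (if does (P? q) then just q else g qs)) →
  ∀ xs → g xs ≡ find P? xs
find-unique P? g g[] g∷ []       = g[]
find-unique P? g g[] g∷ (q ∷ qs) =
  trans (g∷ q qs) (cong (if does (P? q) then just q else_) (find-unique P? g g[] g∷ qs))

-- The `_` is the local search function of `candidate`: once `reverse L` is
-- abstracted to a variable, unification can read it off the goal.
candidate≡find : ∀ t L w → candidate t L w ≡ find (hoppable? t w) (reverse L)
candidate≡find t L w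
  with find-unique (hoppable? t w) _ refl (λ q _ → if-does-×-dec (t <? q) (q ∈? rightOf t w) (just q) _)
     | reverse L
... | go≗find | M = go≗find M

candidate-∷ : ∀ t a L w → candidate t (a ∷ L) w ≡ (candidate t L w <∣> find (hoppable? t w) [ a ])
candidate-∷ t a L w = begin
  candidate t (a ∷ L) w
    ≡⟨ candidate≡find t (a ∷ L) w ⟩
  find (hoppable? t w) (reverse (a ∷ L))
    ≡⟨ cong (find (hoppable? t w)) (unfold-reverse a L) ⟩
  find (hoppable? t w) (reverse L ++ [ a ])
    ≡⟨ find-++ (hoppable? t w) (reverse L) [ a ] ⟩
  (find (hoppable? t w) (reverse L) <∣> find (hoppable? t w) [ a ])
    ≡⟨ cong (_<∣> _) (sym (candidate≡find t L w)) ⟩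
  (candidate t L w <∣> find (hoppable? t w) [ a ])
    ∎

candidate-just⇒∈ : ∀ {t L w q} → candidate t L w ≡ just q → q ∈ L
candidate-just⇒∈ {t} {L} {w} eq =
  reverse⁻ (find-just⇒∈ (hoppable? t w) (reverse L) (trans (sym (candidate≡find t L w)) eq))

candidate-nothing⇒¬hoppable : ∀ {t L w} → candidate t L w ≡ nothing → ∀ {q} → q ∈ L → ¬ Hoppable t w q
candidate-nothing⇒¬hoppable {t} {L} {w} eq q∈L =
  find-nothing⇒¬ (hoppable? t w) (reverse L) (trans (sym (candidate≡find t L w)) eq) (reverse⁺ q∈L)

¬hoppable⇒candidate-nothing : ∀ {t L w} → (∀ {q} → q ∈ L → ¬ Hoppable t w q) → candidate t L w ≡ nothing
¬hoppable⇒candidate-nothing {t} {L} {w} ¬hop =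
  trans (candidate≡find t L w) (¬⇒find-nothing (hoppable? t w) (reverse L) (¬hop ∘ reverse⁻))

hoppable-sMul : ∀ {i q} w → suc (suc i) ≤ q → Hoppable i (sMul i w) q ⇔ Hoppable (suc i) w q
hoppable-sMul {i} {q} w i+2≤q = mk⇔
  (λ (_ , q∈) → i+2≤q , subst (_∈ _) q-fixed (∈-map-transpose⁻ (subst (q ∈_) (rightOf-sMul i w) q∈)))
  (λ (_ , q∈) → <⇒≤ i+2≤q , subst (q ∈_) (sym (rightOf-sMul i w))
                                 (∈-map-transpose⁺ (subst (_∈ _) (sym q-fixed) q∈)))
  where
  q-fixed : s i q ≡ q
  q-fixed = transpose-fixed (<⇒≢ (<⇒≤ i+2≤q) ∘ sym) (<⇒≢ i+2≤q ∘ sym)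

candidate-sMul : ∀ {i L} w → All (suc (suc i) ≤_) L → candidate i L (sMul i w) ≡ candidate (suc i) L w
candidate-sMul {i} {L} w L≥ = begin
  candidate i L (sMul i w)
    ≡⟨ candidate≡find i L (sMul i w) ⟩
  find (hoppable? i (sMul i w)) (reverse L)
    ≡⟨ find-cong _ _ (reverse L) (λ q∈ → hoppable-sMul w (All.lookup L≥ (reverse⁻ q∈))) ⟩
  find (hoppable? (suc i) w) (reverse L)
    ≡⟨ sym (candidate≡find (suc i) L w) ⟩
  candidate (suc i) L w
    ∎

candidate-sMul-∷ : ∀ {i L u} → All (suc (suc i) ≤_) L → candidate (suc i) L u ≡ nothing →
  candidate i (suc i ∷ L) (sMul i u) ≡ find (hoppable? i (sMul i u)) [ suc i ]
candidate-sMul-∷ {i} {L} {u} L≥ terminal = begin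
  candidate i (suc i ∷ L) (sMul i u)
    ≡⟨ candidate-∷ i (suc i) L (sMul i u) ⟩
  (candidate i L (sMul i u) <∣> find (hoppable? i (sMul i u)) [ suc i ])
    ≡⟨ cong (_<∣> _) (trans (candidate-sMul u L≥) terminal) ⟩
  find (hoppable? i (sMul i u)) [ suc i ]
    ∎

-- Inversions and the Demazure product

-- `len (x ∷ xs)` is definitionally `countBelow x xs + len xs`.
countBelow : ℕ → List ℕ → ℕ
countBelow c xs = length (filter (_<? c) xs)

countBelow-map : ∀ {f c c′} xs → (∀ {y} → y ∈ xs → f y < c′ ⇔ y < c) → countBelow c′ (map f xs) ≡ countBelow c xs
countBelow-map [] _ = refl
countBelow-map {f} {c} {c′} (y ∷ ys) f⇔ with f y <ᵇ c′ | proof (f y <? c′) | y <ᵇ c | proof (y <? c)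
... | true  | ofʸ _   | true  | ofʸ _   = cong suc (countBelow-map ys (f⇔ ∘ there))
... | false | ofⁿ _   | false | ofⁿ _   = countBelow-map ys (f⇔ ∘ there)
... | true  | ofʸ fy< | false | ofⁿ y≮ = ⊥-elim (y≮ (to (f⇔ (here refl)) fy<))
... | false | ofⁿ fy≮ | true  | ofʸ y< = ⊥-elim (fy≮ (from (f⇔ (here refl)) y<))

countBelow-cong : ∀ {c c′} xs → (∀ {y} → y ∈ xs → y < c′ ⇔ y < c) → countBelow c′ xs ≡ countBelow c xs
countBelow-cong {c} {c′} xs iff = trans (cong (countBelow c′) (sym (map-id xs))) (countBelow-map xs iff)

<-suc⇔ : ∀ {y c} → y ≢ c → y < suc c ⇔ y < c
<-suc⇔ y≢c = mk⇔ (λ y<sc → ≤∧≢⇒< (≤-pred y<sc) y≢c) m<n⇒m<1+n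

countBelow-∷< : ∀ {c x} xs → x < c → countBelow c (x ∷ xs) ≡ suc (countBelow c xs)
countBelow-∷< {c} xs x<c = cong length (filter-accept (_<? c) x<c)

countBelow-∷≮ : ∀ {c x} xs → ¬ x < c → countBelow c (x ∷ xs) ≡ countBelow c xs
countBelow-∷≮ {c} xs x≮c = cong length (filter-reject (_<? c) x≮c)

countBelow-suc : ∀ {c xs} → Unique xs → c ∈ xs → countBelow (suc c) xs ≡ suc (countBelow c xs)
countBelow-suc {_} {x ∷ xs} (x∉xs ∷ _) (here refl) = begin
  countBelow (suc x) (x ∷ xs)   ≡⟨ countBelow-∷< xs (n<1+n x) ⟩
  suc (countBelow (suc x) xs)   ≡⟨ cong suc (countBelow-cong xs (λ y∈ → <-suc⇔ (λ { refl → All¬⇒¬Any x∉xs y∈ }))) ⟩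
  suc (countBelow x xs)         ≡⟨ cong suc (sym (countBelow-∷≮ xs (<-irrefl refl))) ⟩
  suc (countBelow x (x ∷ xs))   ∎
countBelow-suc {c} {x ∷ xs} (x∉xs ∷ xs!) (there c∈xs) with x <? c
... | yes x<c = begin
  countBelow (suc c) (x ∷ xs)   ≡⟨ countBelow-∷< xs (m<n⇒m<1+n x<c) ⟩
  suc (countBelow (suc c) xs)   ≡⟨ cong suc (countBelow-suc xs! c∈xs) ⟩
  suc (suc (countBelow c xs))   ≡⟨ cong suc (sym (countBelow-∷< xs x<c)) ⟩
  suc (countBelow c (x ∷ xs))   ∎
... | no x≮c = begin
  countBelow (suc c) (x ∷ xs)   ≡⟨ countBelow-∷≮ xs (x≮c ∘ to (<-suc⇔ (λ { refl → All¬⇒¬Any x∉xs c∈xs }))) ⟩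
  countBelow (suc c) xs         ≡⟨ countBelow-suc xs! c∈xs ⟩
  suc (countBelow c xs)         ≡⟨ cong suc (sym (countBelow-∷≮ xs x≮c)) ⟩
  suc (countBelow c (x ∷ xs))   ∎

len-map : ∀ {f} w → (∀ {x y} → x ∈ w → y ∈ w → f y < f x ⇔ y < x) → len (map f w) ≡ len w
len-map []       _   = refl
len-map (x ∷ xs) ord =
  cong₂ _+_ (countBelow-map xs (ord (here refl) ∘ there)) (len-map xs (λ x∈ y∈ → ord (there x∈) (there y∈)))

<-suc-left⇔ : ∀ {i x} → x ≢ suc i → i < x ⇔ suc i < x
<-suc-left⇔ x≢si = mk⇔ (λ i<x → ≤∧≢⇒< i<x (x≢si ∘ sym)) <⇒≤

s-<-fixed⇔ : ∀ {i x} y → x ≢ i → x ≢ suc i → s i y < x ⇔ y < x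
s-<-fixed⇔ {i} y x≢i x≢si with s i y | transposed i (suc i) y
... | _ | moved-a refl   = ⇔-sym (<-suc-left⇔ x≢si)
... | _ | moved-b _ refl = <-suc-left⇔ x≢si
... | _ | fixed _ _      = ⇔-id _

s-<⇔ : ∀ {i x y} → x ≢ i → y ≢ i → s i y < s i x ⇔ y < x
s-<⇔ {i} {x} {y} x≢i y≢i with s i x | transposed i (suc i) x
... | _ | moved-a x≡i    = ⊥-elim (x≢i x≡i)
... | _ | fixed _ x≢si   = s-<-fixed⇔ y x≢i x≢si
... | _ | moved-b _ refl with s i y | transposed i (suc i) y
...   | _ | moved-a y≡i    = ⊥-elim (y≢i y≡i)
...   | _ | moved-b _ refl = mk⇔ s≤s ≤-pred
...   | _ | fixed _ _      = ⇔-sym (<-suc⇔ y≢i)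

s-<-suc⇔ : ∀ {i y} → y ≢ i → s i y < suc i ⇔ y < suc (suc i)
s-<-suc⇔ {i} {y} y≢i with s i y | transposed i (suc i) y
... | _ | moved-a y≡i    = ⊥-elim (y≢i y≡i)
... | _ | moved-b _ refl = mk⇔ (λ _ → n<1+n (suc i)) (λ _ → n<1+n i)
... | _ | fixed _ y≢si   = ⇔-sym (<-suc⇔ y≢si)

len-sMul-∉ : ∀ {i} w → i ∉ w → len (sMul i w) ≡ len w
len-sMul-∉ w i∉w = len-map w (λ x∈ y∈ → s-<⇔ (λ { refl → i∉w x∈ }) (λ { refl → i∉w y∈ }))

-- Left multiplication by s_i adds exactly the inversion (i, i+1) when i
-- precedes i+1, and changes no other comparison.
len-sMul-ascent : ∀ {i} w → Unique w → suc i ∈ rightOf i w → len (sMul i w) ≡ suc (len w)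
len-sMul-ascent {i} (x ∷ xs) (x∉xs ∷ xs!) si∈ with s i x | transposed i (suc i) x
... | _ | moved-a refl = cong₂ _+_ count (len-sMul-∉ xs (All¬⇒¬Any x∉xs))
  where
  si∈xs : suc i ∈ xs
  si∈xs = subst (suc i ∈_) (rightOf-head i xs) si∈
  ≢i : ∀ {y} → y ∈ xs → y ≢ i
  ≢i y∈ refl = All¬⇒¬Any x∉xs y∈
  count : countBelow (suc i) (sMul i xs) ≡ suc (countBelow i xs)
  count = begin
    countBelow (suc i) (sMul i xs)      ≡⟨ countBelow-map xs (s-<-suc⇔ ∘ ≢i) ⟩
    countBelow (suc (suc i)) xs         ≡⟨ countBelow-suc xs! si∈xs ⟩
    suc (countBelow (suc i) xs)         ≡⟨ cong suc (countBelow-cong xs (<-suc⇔ ∘ ≢i)) ⟩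
    suc (countBelow i xs)               ∎
... | _ | moved-b x≢i refl =
  ⊥-elim (All¬⇒¬Any x∉xs (rightOf-⊆ xs (subst (suc i ∈_) (rightOf-tail xs x≢i) si∈)))
... | _ | fixed x≢i x≢si = begin
  countBelow x (sMul i xs) + len (sMul i xs)
    ≡⟨ cong₂ _+_ (countBelow-map xs (λ {y} _ → s-<-fixed⇔ y x≢i x≢si))
                 (len-sMul-ascent xs xs! (subst (suc i ∈_) (rightOf-tail xs x≢i) si∈)) ⟩
  countBelow x xs + suc (len xs)
    ≡⟨ +-suc (countBelow x xs) (len xs) ⟩
  suc (len (x ∷ xs)) ∎

sMul-involutive : ∀ i w → sMul i (sMul i w) ≡ w
sMul-involutive i = map-transpose-involutive i (suc i)

Unique-sMul : ∀ {i w} → Unique w → Unique (sMul i w)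
Unique-sMul {i} = map⁺ (transpose-injective i (suc i))

len-sMul-descent : ∀ {i} w → Unique w → i ∈ rightOf (suc i) w → suc (len (sMul i w)) ≡ len w
len-sMul-descent {i} w w! i∈ = begin
  suc (len (sMul i w))       ≡⟨ sym (len-sMul-ascent (sMul i w) (Unique-sMul w!) (from (suc∈rightOf-sMul⇔ i w) i∈)) ⟩
  len (sMul i (sMul i w))    ≡⟨ cong len (sMul-involutive i w) ⟩
  len w                      ∎

sDem-cases : ∀ i u → sDem i u ≡ u ⊎ sDem i u ≡ sMul i u
sDem-cases i u with len (sMul i u) <ᵇ len u
... | true  = inj₁ refl
... | false = inj₂ refl

sDem-descent : ∀ {i u} → Unique u → i ∈ rightOf (suc i) u → sDem i u ≡ u
sDem-descent {i} {u} u! i∈ with len (sMul i u) <ᵇ len u | proof (len (sMul i u) <? len u)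
... | true  | ofʸ _ = refl
... | false | ofⁿ ≮ = ⊥-elim (≮ (≤-reflexive (len-sMul-descent u u! i∈)))

sDem-ascent : ∀ {i u} → Unique u → suc i ∈ rightOf i u → sDem i u ≡ sMul i u
sDem-ascent {i} {u} u! si∈ with len (sMul i u) <ᵇ len u | proof (len (sMul i u) <? len u)
... | true  | ofʸ < = ⊥-elim (1+n≰n (<⇒≤ (subst (_< len u) (len-sMul-ascent u u! si∈) <)))
... | false | ofⁿ _ = refl

-- Hopping

Hop-terminal : ∀ {t L w w′} → Hop t L w w′ → candidate t L w′ ≡ nothing
Hop-terminal (stop none)   = none
Hop-terminal (step _ hops) = Hop-terminal hops

swapVals-sMul : ∀ {i q} → q ≢ i → q ≢ suc i → ∀ w → swapVals i q (sMul i w) ≡ sMul i (swapVals (suc i) q w)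
swapVals-sMul {i} {q} q≢i q≢si w = begin
  map (transpose i q) (map (s i) w)       ≡⟨ sym (map-∘ w) ⟩
  map (transpose i q ∘ s i) w             ≡⟨ map-cong conjugate w ⟩
  map (s i ∘ transpose (suc i) q) w       ≡⟨ map-∘ w ⟩
  map (s i) (map (transpose (suc i) q) w) ∎
  where
  conjugate : ∀ x → transpose i q (s i x) ≡ s i (transpose (suc i) q x)
  conjugate x =
    subst₂ (λ a b → transpose a b (s i x) ≡ s i (transpose (suc i) q x))
           (transposeʳ i (suc i)) (transpose-fixed q≢i q≢si)
           (transpose-conjugate (transpose-injective i (suc i)) (suc i) q x)

-- The extra candidate i+1 heads the list, so it has the lowest priority: as
-- long as some entry of L can be hopped over, h_{i,(i+1)∷L} makes the hops of
-- h_{i+1,L} translated by s_i.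
Hop-sMul : ∀ {i L x u r} → All (suc (suc i) ≤_) L →
  Hop (suc i) L x u → Hop i (suc i ∷ L) (sMul i u) r → Hop i (suc i ∷ L) (sMul i x) r
Hop-sMul L≥ (stop _) rest = rest
Hop-sMul {i} {L} {x} {r = r} L≥ (step {q = q} cand hops) rest =
  step cand′ (subst (λ w → Hop i (suc i ∷ L) w r) (sym (swapVals-sMul q≢i q≢si x)) (Hop-sMul L≥ hops rest))
  where
  i+2≤q : suc (suc i) ≤ q
  i+2≤q = All.lookup L≥ (candidate-just⇒∈ cand)
  q≢i : q ≢ i
  q≢i = <⇒≢ (<⇒≤ i+2≤q) ∘ sym
  q≢si : q ≢ suc i
  q≢si = <⇒≢ i+2≤q ∘ sym
  cand′ : candidate i (suc i ∷ L) (sMul i x) ≡ just q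
  cand′ = begin
    candidate i (suc i ∷ L) (sMul i x)
      ≡⟨ candidate-∷ i (suc i) L (sMul i x) ⟩
    (candidate i L (sMul i x) <∣> find (hoppable? i (sMul i x)) [ suc i ])
      ≡⟨ cong (_<∣> _) (trans (candidate-sMul x L≥) cand) ⟩
    just q
      ∎

hop-sDem : ∀ {i L u} → Unique u → i ∈ u → suc i ∈ u → All (suc (suc i) ≤_) L →
  candidate (suc i) L u ≡ nothing → Hop i (suc i ∷ L) (sMul i u) (sDem i u)
hop-sDem {i} {L} {u} u! i∈u si∈u L≥ terminal with rightOf-total (<⇒≢ (n<1+n i)) i∈u si∈u
... | inj₁ i∈ =
  subst (Hop i (suc i ∷ L) (sMul i u)) (sym (sDem-descent u! i∈))
    (step hop-back (subst (λ w → Hop i (suc i ∷ L) w u) (sym (sMul-involutive i u)) (stop stuck)))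
  where
  hop-back : candidate i (suc i ∷ L) (sMul i u) ≡ just (suc i)
  hop-back rewrite candidate-sMul-∷ L≥ terminal
                 | dec-true (hoppable? i (sMul i u) (suc i)) (n<1+n i , from (suc∈rightOf-sMul⇔ i u) i∈) = refl
  stuck : candidate i (suc i ∷ L) u ≡ nothing
  stuck = ¬hoppable⇒candidate-nothing {i} {suc i ∷ L} {u} λ where
    (here refl) (_ , si∈) → rightOf-irrefl u! (rightOf-trans u! i∈ si∈)
    (there q∈L) (_ , q∈)  → candidate-nothing⇒¬hoppable terminal q∈L (All.lookup L≥ q∈L , rightOf-trans u! i∈ q∈)
... | inj₂ si∈ =
  subst (Hop i (suc i ∷ L) (sMul i u)) (sym (sDem-ascent u! si∈)) (stop stuck)
  where
  stuck : candidate i (suc i ∷ L) (sMul i u) ≡ nothing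
  stuck = trans (candidate-sMul-∷ L≥ terminal) (¬⇒find-nothing (hoppable? i (sMul i u)) [ suc i ] λ where
    (here refl) (_ , si∈′) → rightOf-irrefl u! (rightOf-trans u! si∈ (to (suc∈rightOf-sMul⇔ i u) si∈′)))

-- The induction along s_i s_{i+1} ⋯ s_j

record Covers (n : ℕ) (w : List ℕ) : Set where
  field
    unique   : Unique w
    complete : ∀ {x} → 1 ≤ x → x ≤ n → x ∈ w

open Covers

IsPerm⇒Covers : ∀ {n v} → IsPerm n v → Covers n v
IsPerm⇒Covers {n} {v} v↭ = record
  { unique   = Unique-resp-↭ (setoid ℕ) (↭⇒↭ₛ (↭-sym v↭)) (applyUpTo⁺₁ suc n (λ i<j _ → <⇒≢ i<j ∘ suc-injective))
  ; complete = λ { {suc x} _ x<n → ∈-resp-↭ (↭-sym v↭) (∈-applyUpTo⁺ suc x<n) }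
  }

Covers-sMul : ∀ {n a w} → 1 ≤ a → a < n → Covers n w → Covers n (sMul a w)
Covers-sMul {n} {a} 1≤a a<n cw = record
  { unique   = Unique-sMul (unique cw)
  ; complete = λ {x} 1≤x x≤n →
      let (1≤x′ , x′≤n) = transpose-preserves {λ y → 1 ≤ y × y ≤ n} a (suc a) x (1≤a , <⇒≤ a<n) (s≤s z≤n , a<n) (1≤x , x≤n)
      in ∈-map-transpose⁺ (complete cw 1≤x′ x′≤n)
  }

Covers-demWord : ∀ {n ws v} → All (λ a → 1 ≤ a × a < n) ws → Covers n v → Covers n (demWord ws v)
Covers-demWord {ws = []}         []                   cv = cv
Covers-demWord {ws = a ∷ ws} {v} ((1≤a , a<n) ∷ gens) cv with sDem-cases a (demWord ws v)
... | inj₁ eq = subst (Covers _) (sym eq) (Covers-demWord gens cv)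
... | inj₂ eq = subst (Covers _) (sym eq) (Covers-sMul 1≤a a<n (Covers-demWord gens cv))

ascending : ℕ → ℕ → List ℕ
ascending a zero    = []
ascending a (suc k) = a ∷ ascending (suc a) k

∈-ascending⁻ : ∀ {a k x} → x ∈ ascending a k → a ≤ x × x < a + k
∈-ascending⁻ {a} {suc k} (here refl) = ≤-refl , m<m+n a z<s
∈-ascending⁻ {a} {suc k} {x} (there x∈) =
  let (a<x , x<) = ∈-ascending⁻ x∈ in <⇒≤ a<x , subst (x <_) (sym (+-suc a k)) x<

applyUpTo-ascending : ∀ {f} a k → (∀ m → f m ≡ a + m) → applyUpTo f k ≡ ascending a k
applyUpTo-ascending a zero    f≡ = refl
applyUpTo-ascending a (suc k) f≡ =
  cong₂ _∷_ (trans (f≡ 0) (+-identityʳ a)) (applyUpTo-ascending (suc a) k (λ m → trans (f≡ (suc m)) (+-suc a m)))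

interval≡ascending : ∀ a b → interval a b ≡ ascending a (suc (b ∸ a))
interval≡ascending a b = applyUpTo-ascending a (suc (b ∸ a)) (λ _ → refl)

hop-ascending : ∀ {n} k i v → All (λ a → 1 ≤ a × a < n) (ascending i k) → Covers n v →
  Hop i (ascending (suc i) k) (mulWord (ascending i k) v) (demWord (ascending i k) v)
hop-ascending zero    i v _                      _  = stop refl
hop-ascending (suc k) i v ((1≤i , i<n) ∷ gens) cv =
  Hop-sMul above hops (hop-sDem (unique cu) (complete cu 1≤i (<⇒≤ i<n)) (complete cu (s≤s z≤n) i<n) above (Hop-terminal hops))
  where
  hops = hop-ascending k (suc i) v gens cv
  cu   = Covers-demWord gens cv
  above : All (suc (suc i) ≤_) (ascending (suc (suc i)) k)
  above = All.tabulate (proj₁ ∘ ∈-ascending⁻)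

proposition2p4 : (n i j : ℕ) → 1 ≤ i → i ≤ j → suc j ≤ n →
    (v : List ℕ) → IsPerm n v →
    Hop i (interval (suc i) (suc j)) (mulWord (interval i j) v) (demWord (interval i j) v)
proposition2p4 n i j 1≤i i≤j j<n v v-perm =
  subst₂ (λ L ws → Hop i L (mulWord ws v) (demWord ws v))
         (sym (interval≡ascending (suc i) (suc j))) (sym (interval≡ascending i j))
         (hop-ascending (suc (j ∸ i)) i v generators (IsPerm⇒Covers v-perm))
  where
  end : i + suc (j ∸ i) ≡ suc j
  end = trans (+-suc i (j ∸ i)) (cong suc (m+[n∸m]≡n i≤j))
  generators : All (λ a → 1 ≤ a × a < n) (ascending i (suc (j ∸ i)))
  generators = All.tabulate λ {a} a∈ →
    let (i≤a , a<end) = ∈-ascending⁻ a∈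
    in ≤-trans 1≤i i≤a , ≤-trans (subst (a <_) end a<end) j<n
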